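{- Let $G$ be a bipartite graph with bipartition classes $X$ and $Y$, and let $\varphi$ be a $2$-coloring of $G$. Then $$\mathrm{fix}^{\varphi}_2(G)=\sum_{C\text{ connected component of }G}\min\Big\{\big|\big(X\ominus\varphi^{ -1}(1)\big)\cap V(C)\big|,\ \big|\big(X\ominus\varphi^{ -1}(2)\big)\cap V(C)\big|\Big\}.$$
   Context: A $2$-coloring of $G$ is any map $\varphi\colon V(G)\to\{1,2\}$ (not necessarily proper); it is proper if adjacent vertices receive different colors. For sets $A,B$, $A\ominus B$ denotes the symmetric difference $(A\setminus B)\cup(B\setminus A)$. For an $r$-coloring $\varphi$ of $G$, $\mathrm{fix}^{\varphi}_r(G)$ denotes the minimum number of vertices on which $\varphi$ and a proper $r$-coloring $\varphi'$ of $G$ differ, minimized over all proper $r$-colorings $\varphi'$ (and $\infty$ if none exists). -}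

module Defs where

open import Data.Nat using (ℕ; zero; suc; _+_; _≤_)
open import Data.Nat.Base using (_⊓_)
open import Data.Fin using (Fin; zero; suc)
open import Data.Fin.Properties using (_≟_)
open import Data.Bool using (Bool; _∧_; true; false; not; _xor_; if_then_else_)
open import Data.Product using (Σ; _×_; _,_)
open import Relation.Binary.PropositionalEquality using (_≡_; _≢_)
open import Relation.Nullary.Decidable using (⌊_⌋)

record Graph (n : ℕ) : Set where
  field
    adj   : Fin n → Fin n → Bool
    sym   : ∀ u v → adj u v ≡ adj v u
    irrefl : ∀ v → adj v v ≡ false
open Graph public

Adj : ∀ {n} → Graph n → Fin n → Fin n → Set
Adj G u v = adj G u v ≡ true

-- X is a bipartition class (characteristic function); Y is its complement.
-- Every edge has exactly one end in X (and hence one in Y).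
IsBipartition : ∀ {n} → Graph n → (Fin n → Bool) → Set
IsBipartition G X = ∀ u v → Adj G u v → X u ≡ not (X v)

-- A 2-coloring: colors 1 and 2 are represented by zero and suc zero of Fin 2.
Coloring : ℕ → Set
Coloring n = Fin n → Fin 2

colour1 : Fin 2
colour1 = zero

Proper : ∀ {n} → Graph n → Coloring n → Set
Proper G ψ = ∀ u v → Adj G u v → ψ u ≢ ψ v

count : ∀ {n} → (Fin n → Bool) → ℕ
count {zero}  P = 0
count {suc n} P = (if P zero then 1 else 0) + count (λ v → P (suc v))

sumFin : ∀ {m} → (Fin m → ℕ) → ℕ
sumFin {zero}  f = 0
sumFin {suc m} f = f zero + sumFin (λ i → f (suc i))

dist : ∀ {n} → Coloring n → Coloring n → ℕ
dist φ ψ = count (λ v → not ⌊ φ v ≟ ψ v ⌋)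

FixIs : ∀ {n} → Graph n → Coloring n → ℕ → Set
FixIs G φ k =
  Σ (Coloring _) (λ ψ → Proper G ψ × dist φ ψ ≡ k)
  × (∀ ψ → Proper G ψ → k ≤ dist φ ψ)

data Reach {n} (G : Graph n) (u : Fin n) : Fin n → Set where
  here : Reach G u u
  step : ∀ {w v} → Reach G u w → Adj G w v → Reach G u v

IsComponentLabelling : ∀ {n m} → Graph n → (Fin n → Fin m) → Set
IsComponentLabelling {n} {m} G c =
  (∀ u v → c u ≡ c v → Reach G u v)
  × (∀ u v → Reach G u v → c u ≡ c v)
  × (∀ (i : Fin m) → Σ (Fin n) (λ v → c v ≡ i))

symDiffMem : ∀ {n} → (Fin n → Bool) → Coloring n → Fin 2 → Fin n → Bool
symDiffMem X φ col v = X v xor ⌊ φ v ≟ col ⌋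

compCount : ∀ {n m} → (Fin n → Bool) → Coloring n → (Fin n → Fin m) → Fin 2 → Fin m → ℕ
compCount X φ c col i = count (λ v → symDiffMem X φ col v ∧ ⌊ c v ≟ i ⌋)

-- Each connected component of a bipartite graph has exactly two proper 2-colourings: the one
-- giving X-vertices colour κ and Y-vertices the other colour, for κ ∈ {1, 2}. Such a colouring
-- disagrees with φ on v exactly when v ∈ X ⊖ φ⁻¹(κ), and the components can be recoloured
-- independently, so the optimum picks the cheaper κ on every component.
module Submission where

open import Defs
open import Data.Nat using (ℕ; _⊓_; zero; suc; _+_; _≤_; _≤?_)
open import Data.Nat.Properties
  using (≤-refl; ≤-reflexive; ≤-trans; +-mono-≤; m⊓n≤m; m⊓n≤n; m≤n⇒m⊓n≡m; m≥n⇒m⊓n≡n; ≰⇒≥;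
         +-commutativeSemigroup)
open import Algebra.Properties.CommutativeSemigroup +-commutativeSemigroup using (interchange)
open import Data.Fin using (Fin; zero; suc)
open import Data.Fin.Properties using (_≟_)
open import Data.Bool using (Bool; true; false; not; _∧_; _xor_; if_then_else_)
open import Data.Bool.Properties using (∧-zeroʳ; ∧-identityʳ)
open import Data.Product using (_,_; proj₁; proj₂)
open import Data.Empty using (⊥-elim)
open import Relation.Nullary using (yes; no)
open import Relation.Nullary.Decidable using (⌊_⌋)
open import Relation.Binary.PropositionalEquality
  using (_≡_; _≢_; refl; trans; cong; cong₂; module ≡-Reasoning)
  renaming (sym to ≡-sym)

sumFin-cong : ∀ {m} {f g : Fin m → ℕ} → (∀ i → f i ≡ g i) → sumFin f ≡ sumFin g
sumFin-cong {zero}  f≡g = refl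
sumFin-cong {suc m} f≡g = cong₂ _+_ (f≡g zero) (sumFin-cong (λ i → f≡g (suc i)))

sumFin-mono-≤ : ∀ {m} {f g : Fin m → ℕ} → (∀ i → f i ≤ g i) → sumFin f ≤ sumFin g
sumFin-mono-≤ {zero}  f≤g = ≤-refl
sumFin-mono-≤ {suc m} f≤g = +-mono-≤ (f≤g zero) (sumFin-mono-≤ (λ i → f≤g (suc i)))

sumFin-zero : ∀ m → sumFin {m} (λ _ → 0) ≡ 0
sumFin-zero zero    = refl
sumFin-zero (suc m) = sumFin-zero m

sumFin-+ : ∀ {m} (f g : Fin m → ℕ) → sumFin (λ i → f i + g i) ≡ sumFin f + sumFin g
sumFin-+ {zero}  f g = refl
sumFin-+ {suc m} f g = begin
  f zero + g zero + sumFin (λ i → f (suc i) + g (suc i))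
    ≡⟨ cong (f zero + g zero +_) (sumFin-+ (λ i → f (suc i)) (λ i → g (suc i))) ⟩
  f zero + g zero + (sumFin (λ i → f (suc i)) + sumFin (λ i → g (suc i)))
    ≡⟨ interchange (f zero) (g zero) _ _ ⟩
  f zero + sumFin (λ i → f (suc i)) + (g zero + sumFin (λ i → g (suc i))) ∎
  where open ≡-Reasoning

indicator : Bool → ℕ
indicator b = if b then 1 else 0

sumFin-indicator-≟ : ∀ {m} (k : Fin m) → sumFin (λ i → indicator ⌊ k ≟ i ⌋) ≡ 1
sumFin-indicator-≟ {suc m} zero    = cong suc (sumFin-zero m)
sumFin-indicator-≟ {suc m} (suc k) = trans (sumFin-cong shift) (sumFin-indicator-≟ k)
  where
  shift : ∀ i → indicator ⌊ suc k ≟ suc i ⌋ ≡ indicator ⌊ k ≟ i ⌋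
  shift i with k ≟ i
  ... | yes _ = refl
  ... | no  _ = refl

sumFin-indicator-∧-≟ : ∀ {m} (b : Bool) (k : Fin m) →
  sumFin (λ i → indicator (b ∧ ⌊ k ≟ i ⌋)) ≡ indicator b
sumFin-indicator-∧-≟ {m} false k = sumFin-zero m
sumFin-indicator-∧-≟     true  k = sumFin-indicator-≟ k

count-cong : ∀ {n} {P Q : Fin n → Bool} → (∀ v → P v ≡ Q v) → count P ≡ count Q
count-cong {zero}  P≡Q = refl
count-cong {suc n} P≡Q =
  cong₂ _+_ (cong indicator (P≡Q zero)) (count-cong (λ v → P≡Q (suc v)))

count-partition : ∀ {n m} (P : Fin n → Bool) (c : Fin n → Fin m) →
  count P ≡ sumFin (λ i → count (λ v → P v ∧ ⌊ c v ≟ i ⌋))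
count-partition {zero}  {m} P c = ≡-sym (sumFin-zero m)
count-partition {suc n} {m} P c = begin
  indicator (P zero) + count (λ v → P (suc v))
    ≡⟨ cong₂ _+_ (≡-sym (sumFin-indicator-∧-≟ (P zero) (c zero)))
                 (count-partition (λ v → P (suc v)) (λ v → c (suc v))) ⟩
  sumFin (λ i → indicator (P zero ∧ ⌊ c zero ≟ i ⌋))
    + sumFin (λ i → count (λ v → P (suc v) ∧ ⌊ c (suc v) ≟ i ⌋))
    ≡⟨ ≡-sym (sumFin-+ {m} (λ i → indicator (P zero ∧ ⌊ c zero ≟ i ⌋)) _) ⟩
  sumFin (λ i → count (λ v → P v ∧ ⌊ c v ≟ i ⌋)) ∎
  where open ≡-Reasoning

other : Fin 2 → Fin 2
other zero       = suc zero
other (suc zero) = zero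

other-≢ : ∀ a → other a ≢ a
other-≢ zero       ()
other-≢ (suc zero) ()

≢-other⇒≡ : ∀ {a b : Fin 2} → a ≢ other b → a ≡ b
≢-other⇒≡ {zero}       {zero}       _  = refl
≢-other⇒≡ {zero}       {suc zero}   ne = ⊥-elim (ne refl)
≢-other⇒≡ {suc zero}   {zero}       ne = ⊥-elim (ne refl)
≢-other⇒≡ {suc zero}   {suc zero}   _  = refl

sideColour : Fin 2 → Bool → Fin 2
sideColour κ true  = κ
sideColour κ false = other κ

sideColour-not : ∀ κ x → sideColour κ (not x) ≡ other (sideColour κ x)
sideColour-not zero       true  = refl
sideColour-not zero       false = refl
sideColour-not (suc zero) true  = refl
sideColour-not (suc zero) false = refl

sideColour-involutive : ∀ a x → sideColour (sideColour a x) x ≡ a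
sideColour-involutive zero       true  = refl
sideColour-involutive zero       false = refl
sideColour-involutive (suc zero) true  = refl
sideColour-involutive (suc zero) false = refl

sideColour-mismatch : ∀ a κ x → not ⌊ a ≟ sideColour κ x ⌋ ≡ x xor ⌊ a ≟ κ ⌋
sideColour-mismatch zero       zero       true  = refl
sideColour-mismatch zero       zero       false = refl
sideColour-mismatch zero       (suc zero) true  = refl
sideColour-mismatch zero       (suc zero) false = refl
sideColour-mismatch (suc zero) zero       true  = refl
sideColour-mismatch (suc zero) zero       false = refl
sideColour-mismatch (suc zero) (suc zero) true  = refl
sideColour-mismatch (suc zero) (suc zero) false = refl

module Bipartite {n} (G : Graph n) (X : Fin n → Bool) (bip : IsBipartition G X) where

  sideColouring-proper : (κ : Fin n → Fin 2) → (∀ u v → Adj G u v → κ u ≡ κ v) →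
    Proper G (λ v → sideColour (κ v) (X v))
  sideColouring-proper κ κ-const u v uv ψu≡ψv = other-≢ (sideColour (κ v) (X v)) (begin
    other (sideColour (κ v) (X v)) ≡⟨ ≡-sym (sideColour-not (κ v) (X v)) ⟩
    sideColour (κ v) (not (X v))   ≡⟨ cong₂ sideColour (≡-sym (κ-const u v uv)) (≡-sym (bip u v uv)) ⟩
    sideColour (κ u) (X u)         ≡⟨ ψu≡ψv ⟩
    sideColour (κ v) (X v)         ∎)
    where open ≡-Reasoning

  proper-sideColour-reach : ∀ {ψ r v κ} → Proper G ψ → Reach G r v →
    ψ r ≡ sideColour κ (X r) → ψ v ≡ sideColour κ (X v)
  proper-sideColour-reach pr here ψr≡ = ψr≡
  proper-sideColour-reach {ψ} {κ = κ} pr (step {w} {v} rw wv) ψr≡ =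
    ≢-other⇒≡ λ ψv≡ → pr w v wv (begin
      ψ w                          ≡⟨ proper-sideColour-reach pr rw ψr≡ ⟩
      sideColour κ (X w)           ≡⟨ cong (sideColour κ) (bip w v wv) ⟩
      sideColour κ (not (X v))     ≡⟨ sideColour-not κ (X v) ⟩
      other (sideColour κ (X v))   ≡⟨ ≡-sym ψv≡ ⟩
      ψ v                          ∎)
    where open ≡-Reasoning

  module Components {m} (φ : Coloring n) (c : Fin n → Fin m) (lab : IsComponentLabelling G c) where

    mismatches : Coloring n → Fin m → ℕ
    mismatches ψ i = count (λ v → not ⌊ φ v ≟ ψ v ⌋ ∧ ⌊ c v ≟ i ⌋)

    dist-≡-sumFin-mismatches : ∀ ψ → dist φ ψ ≡ sumFin (mismatches ψ)
    dist-≡-sumFin-mismatches ψ = count-partition _ c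

    mismatches-sideColour : ∀ {ψ} κ i → (∀ v → c v ≡ i → ψ v ≡ sideColour κ (X v)) →
      mismatches ψ i ≡ compCount X φ c κ i
    mismatches-sideColour {ψ} κ i on-i = count-cong pointwise
      where
      pointwise : ∀ v → (not ⌊ φ v ≟ ψ v ⌋ ∧ ⌊ c v ≟ i ⌋) ≡ (symDiffMem X φ κ v ∧ ⌊ c v ≟ i ⌋)
      pointwise v with c v ≟ i
      ... | no  _   = trans (∧-zeroʳ _) (≡-sym (∧-zeroʳ _))
      ... | yes cv≡i = begin
        not ⌊ φ v ≟ ψ v ⌋ ∧ true               ≡⟨ ∧-identityʳ _ ⟩
        not ⌊ φ v ≟ ψ v ⌋                      ≡⟨ cong (λ a → not ⌊ φ v ≟ a ⌋) (on-i v cv≡i) ⟩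
        not ⌊ φ v ≟ sideColour κ (X v) ⌋       ≡⟨ sideColour-mismatch (φ v) κ (X v) ⟩
        symDiffMem X φ κ v                     ≡⟨ ≡-sym (∧-identityʳ _) ⟩
        symDiffMem X φ κ v ∧ true              ∎
        where open ≡-Reasoning

    cheapest : Fin m → ℕ
    cheapest i = compCount X φ c zero i ⊓ compCount X φ c (suc zero) i

    cheapest-≤ : ∀ κ i → cheapest i ≤ compCount X φ c κ i
    cheapest-≤ zero       i = m⊓n≤m _ _
    cheapest-≤ (suc zero) i = m⊓n≤n _ _

    -- A proper colouring is a side colouring on each component, with κ read off at a root.
    cheapest-≤-mismatches : ∀ {ψ} → Proper G ψ → ∀ i → cheapest i ≤ mismatches ψ i
    cheapest-≤-mismatches {ψ} pr i with proj₂ (proj₂ lab) i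
    ... | r , cr≡i = ≤-trans (cheapest-≤ κ i) (≤-reflexive (≡-sym (mismatches-sideColour κ i on-i)))
      where
      κ : Fin 2
      κ = sideColour (ψ r) (X r)
      on-i : ∀ v → c v ≡ i → ψ v ≡ sideColour κ (X v)
      on-i v cv≡i = proper-sideColour-reach pr (proj₁ lab r v (trans cr≡i (≡-sym cv≡i)))
                      (≡-sym (sideColour-involutive (ψ r) (X r)))

    bestColour : Fin m → Fin 2
    bestColour i with compCount X φ c zero i ≤? compCount X φ c (suc zero) i
    ... | yes _ = zero
    ... | no  _ = suc zero

    compCount-bestColour : ∀ i → compCount X φ c (bestColour i) i ≡ cheapest i
    compCount-bestColour i with compCount X φ c zero i ≤? compCount X φ c (suc zero) i
    ... | yes A≤B = ≡-sym (m≤n⇒m⊓n≡m A≤B)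
    ... | no  A≰B = ≡-sym (m≥n⇒m⊓n≡n (≰⇒≥ A≰B))

    optimal : Coloring n
    optimal v = sideColour (bestColour (c v)) (X v)

    optimal-proper : Proper G optimal
    optimal-proper = sideColouring-proper (λ v → bestColour (c v))
      (λ u v uv → cong bestColour (proj₁ (proj₂ lab) u v (step here uv)))

    mismatches-optimal : ∀ i → mismatches optimal i ≡ cheapest i
    mismatches-optimal i = trans
      (mismatches-sideColour (bestColour i) i (λ v cv≡i → cong (λ j → sideColour (bestColour j) (X v)) cv≡i))
      (compCount-bestColour i)

proposition5 : ∀ {n m} (G : Graph n) (X : Fin n → Bool) (φ : Coloring n) (c : Fin n → Fin m)
    → IsBipartition G X
    → IsComponentLabelling G c
    → FixIs G φ (sumFin (λ i → compCount X φ c zero i ⊓ compCount X φ c (suc zero) i))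
proposition5 G X φ c bip lab =
    (optimal , optimal-proper , trans (dist-≡-sumFin-mismatches optimal) (sumFin-cong mismatches-optimal))
  , λ ψ pr → ≤-trans (sumFin-mono-≤ (cheapest-≤-mismatches pr))
                     (≤-reflexive (≡-sym (dist-≡-sumFin-mismatches ψ)))
  where open Bipartite.Components G X bip φ c lab
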